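{- For every integer $n\ge 4$, $\mathrm{wdim}_3(K_n\times K_n)=2n$.
   Context: $K_n\times K_n$ is the direct product of two complete graphs: vertex set $[n]\times[n]$ with $[n]=\{1,\dots,n\}$, where $(i,j)$ and $(i',j')$ are adjacent iff $i\ne i'$ and $j\ne j'$. With $d$ the shortest-path distance, for $S\subseteq V$ and vertices $x,y,z$: $\Delta_z(x,y)=|d(x,z)-d(y,z)|$ and $\Delta_S(x,y)=\sum_{z\in S}\Delta_z(x,y)$. A set $S$ of vertices is a weak $k$-resolving set if $\Delta_S(x,y)\ge k$ for all distinct vertices $x,y$. The weak $k$-metric dimension $\mathrm{wdim}_k(G)$ is the minimum cardinality of a weak $k$-resolving set of $G$. -}

module Defs where

open import Data.Bool using (Bool; true; false; _∧_; _∨_; not; if_then_else_)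
open import Data.Nat using (ℕ; zero; suc; _+_; _*_; _≤_; ∣_-_∣)
open import Data.Fin using (Fin)
open import Data.Fin.Properties using () renaming (_≟_ to _≟ᶠ_)
open import Data.Product using (_×_; _,_)
open import Data.List using (List; allFin; cartesianProduct; map)
open import Data.Nat.ListAction using (sum)
open import Data.Bool.ListAction using (any)
open import Relation.Nullary.Decidable using (⌊_⌋)
open import Relation.Binary.PropositionalEquality using (_≡_)
open import Relation.Nullary using (¬_)

Vertex : ℕ → Set
Vertex n = Fin n × Fin n

vertices : (n : ℕ) → List (Vertex n)
vertices n = cartesianProduct (allFin n) (allFin n)

adj : {n : ℕ} → Vertex n → Vertex n → Bool
adj (i , j) (i' , j') = not ⌊ i ≟ᶠ i' ⌋ ∧ not ⌊ j ≟ᶠ j' ⌋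

eqV : {n : ℕ} → Vertex n → Vertex n → Bool
eqV (i , j) (i' , j') = ⌊ i ≟ᶠ i' ⌋ ∧ ⌊ j ≟ᶠ j' ⌋

reach : (n : ℕ) → ℕ → Vertex n → Vertex n → Bool
reach n zero    x y = eqV x y
reach n (suc k) x y = reach n k x y ∨ any (λ z → adj x z ∧ reach n k z y) (vertices n)

leastFrom : ℕ → ℕ → (ℕ → Bool) → ℕ
leastFrom zero       m p = m
leastFrom (suc fuel) m p = if p m then m else leastFrom fuel (suc m) p

-- A shortest path has fewer than n * n edges (the number of vertices), so
-- searching k ∈ [0, n * n) suffices; for unreachable pairs the value is n * n
-- (does not occur for n ≥ 3, where K_n × K_n is connected).
dist : (n : ℕ) → Vertex n → Vertex n → ℕ
dist n x y = leastFrom (n * n) 0 (λ k → reach n k x y)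

VSet : ℕ → Set
VSet n = Vertex n → Bool

card : {n : ℕ} → VSet n → ℕ
card {n} S = sum (map (λ z → if S z then 1 else 0) (vertices n))

Δ : (n : ℕ) → Vertex n → Vertex n → Vertex n → ℕ
Δ n z x y = ∣ dist n x z - dist n y z ∣

ΔS : (n : ℕ) → VSet n → Vertex n → Vertex n → ℕ
ΔS n S x y = sum (map (λ z → if S z then Δ n z x y else 0) (vertices n))

WeakResolving : (n k : ℕ) → VSet n → Set
WeakResolving n k S = (x y : Vertex n) → ¬ (x ≡ y) → k ≤ ΔS n S x y

WdimEq : (n k m : ℕ) → Set
WdimEq n k m =
  (Data.Product.Σ (VSet n) λ S → WeakResolving n k S × card S ≡ m)
  × ((S : VSet n) → WeakResolving n k S → m ≤ card S)

-- For n ≥ 3 the graph has diameter 2: d(x, z) is 0, 1 or 2 according as z = x, z differs from x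
-- in both coordinates, or z shares exactly one coordinate with x. Hence Δ_S is a linear combination
-- of the row counts r, the column counts c and the entries of S: for two vertices of a row,
-- Δ_S((i, j), (i, j′)) = c_j + c_j′ + [(i, j) ∈ S] + [(i, j′) ∈ S], and in general position
-- Δ_S((i, j), (i′, j′)) + [(i, j) ∈ S] + [(i′, j′) ∈ S] + 2 ([(i, j′) ∈ S] + [(i′, j) ∈ S])
--   = r_i + r_i′ + c_j + c_j′.
-- Lower bound: by the row formula any two columns of a weak 3-resolving set carry at least 3 points,
-- so either |S| ≥ 2n or exactly one column carries a single point and every other column at least
-- two; likewise for rows. In that case the general-position formula, applied to a rectangle with two
-- opposite corners in S through the deficient row and column, yields another row or column with at
-- least 3 points, which makes up for the deficit.
-- Upper bound: S = {(p, p), (p, p − 1) : p ∈ ℤ_n} has two points on every line and contains no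
-- rectangle, so both formulas give Δ_S ≥ 3.

module Submission where

open import Defs
open import Data.Bool using (Bool; true; false; _∧_; _∨_; not; if_then_else_)
open import Data.Bool.Properties using (∨-zeroʳ; ∧-zeroʳ; ∧-identityʳ; T-≡)
open import Data.Bool.ListAction using (any)
open import Data.Empty using (⊥; ⊥-elim)
open import Data.Fin using (Fin; zero; suc; toℕ; fromℕ; inject₁; lower₁; punchIn; punchOut)
open import Data.Fin.Patterns using (0F; 1F; 2F)
open import Data.Fin.Properties
  using (_≟_; any?; toℕ-injective; toℕ-fromℕ; toℕ-inject₁; inject₁-lower₁;
         punchInᵢ≢i; punchIn-injective; punchIn-punchOut)
open import Data.List using ([]; _∷_; _++_; map; tabulate; allFin; cartesianProduct)
open import Data.List.Properties using (map-++; map-∘)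
open import Data.List.Membership.Propositional using (_∈_; lose)
open import Data.List.Membership.Propositional.Properties using (∈-cartesianProduct⁺; ∈-allFin)
open import Data.List.Relation.Unary.Any.Properties using (any⁺)
import Data.Nat.ListAction as List
open import Data.Nat.ListAction.Properties using (sum-++)
open import Data.Nat using (ℕ; zero; suc; _+_; _*_; _≤_; z≤n; s≤s; s≤s⁻¹; ∣_-_∣)
import Data.Nat.Properties as ℕ
open import Data.Nat.Properties hiding (_≟_)
open import Algebra.Properties.Semiring.Sum +-*-semiring
  using (sum-syntax; sum-cong-≗; sum-replicate-zero; sum-remove; ∑-distrib-+; ∑-comm; *-distribˡ-sum)
open import Data.Product using (_×_; _,_; proj₁; proj₂; ∃-syntax)
open import Data.Sum using (_⊎_; inj₁; inj₂)
open import Function using (_∘_; id; Equivalence)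
open import Relation.Nullary using (yes; no; does)
open import Relation.Nullary.Decidable using (⌊_⌋; dec-true; dec-false; isYes≗does)
open import Relation.Binary.PropositionalEquality

𝟙 : Bool → ℕ
𝟙 b = if b then 1 else 0

-- `does` rather than ⌊_⌋, so that δ (suc k) (suc i) reduces to δ k i.
δ : ∀ {n} → Fin n → Fin n → ℕ
δ i j = 𝟙 (does (i ≟ j))

𝟙≤1 : ∀ b → 𝟙 b ≤ 1
𝟙≤1 true  = ≤-refl
𝟙≤1 false = z≤n

if-then-0≡*𝟙 : ∀ b m → (if b then m else 0) ≡ m * 𝟙 b
if-then-0≡*𝟙 true  m = sym (*-identityʳ m)
if-then-0≡*𝟙 false m = sym (*-zeroʳ m)

∑-mono-≤ : ∀ {n} {f g : Fin n → ℕ} → (∀ i → f i ≤ g i) → ∑[ i < n ] f i ≤ ∑[ i < n ] g i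
∑-mono-≤ {zero}  _   = z≤n
∑-mono-≤ {suc n} f≤g = +-mono-≤ (f≤g zero) (∑-mono-≤ (f≤g ∘ suc))

∑-const : ∀ n m → ∑[ i < n ] m ≡ n * m
∑-const zero    m = refl
∑-const (suc n) m = cong (m +_) (∑-const n m)

n*m≤∑ : ∀ {n m} {f : Fin n → ℕ} → (∀ i → m ≤ f i) → n * m ≤ ∑[ i < n ] f i
n*m≤∑ {n} {m} m≤f = subst (_≤ _) (∑-const n m) (∑-mono-≤ m≤f)

∑-δ* : ∀ {n} (k : Fin n) (f : Fin n → ℕ) → ∑[ i < n ] (δ k i * f i) ≡ f k
∑-δ* {suc n} zero    f = trans (cong₂ _+_ (+-identityʳ (f zero)) (sum-replicate-zero n)) (+-identityʳ (f zero))
∑-δ* {suc n} (suc k) f = ∑-δ* k (f ∘ suc)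

∑-δ : ∀ {n} (k : Fin n) → ∑[ i < n ] δ k i ≡ 1
∑-δ k = trans (sum-cong-≗ (λ i → sym (*-identityʳ (δ k i)))) (∑-δ* k (λ _ → 1))

∑-≥-except : ∀ {n m} (f : Fin (suc n) → ℕ) k → (∀ j → j ≢ k → m ≤ f j) → f k + n * m ≤ ∑[ j < suc n ] f j
∑-≥-except {n} {m} f k m≤f = begin
  f k + n * m                       ≤⟨ +-monoʳ-≤ (f k) (n*m≤∑ (λ j → m≤f (punchIn k j) (punchInᵢ≢i k j))) ⟩
  f k + ∑[ j < n ] f (punchIn k j)  ≡⟨ sum-remove f ⟨
  ∑[ j < suc n ] f j                ∎
  where open ≤-Reasoning

∑-≥-except₂ : ∀ {n m} (f : Fin (2 + n) → ℕ) {k l} → k ≢ l → (∀ j → j ≢ k → j ≢ l → m ≤ f j) →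
            f k + f l + n * m ≤ ∑[ j < 2 + n ] f j
∑-≥-except₂ {n} {m} f {k} {l} k≢l m≤f = begin
  f k + f l + n * m                       ≡⟨ +-assoc (f k) (f l) (n * m) ⟩
  f k + (f l + n * m)                     ≡⟨ cong (λ j → f k + (f j + n * m)) (punchIn-punchOut k≢l) ⟨
  f k + (f (punchIn k l′) + n * m)        ≤⟨ +-monoʳ-≤ (f k) (∑-≥-except (f ∘ punchIn k) l′ others) ⟩
  f k + ∑[ j < suc n ] f (punchIn k j)    ≡⟨ sum-remove f ⟨
  ∑[ j < 2 + n ] f j                      ∎
  where
  open ≤-Reasoning
  l′ = punchOut k≢l
  others : ∀ j → j ≢ l′ → m ≤ f (punchIn k j)
  others j j≢l′ = m≤f (punchIn k j) (punchInᵢ≢i k j)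
    (λ eq → j≢l′ (punchIn-injective k j l′ (trans eq (sym (punchIn-punchOut k≢l)))))

∃-true : ∀ {n} (b : Fin n → Bool) → 1 ≤ ∑[ i < n ] 𝟙 (b i) → ∃[ i ] b i ≡ true
∃-true {suc n} b h with b zero in b₀
... | true  = zero , b₀
... | false = let i , bi = ∃-true (b ∘ suc) h in suc i , bi

∃-true-except : ∀ {n} (b : Fin (suc n) → Bool) k → 1 + 𝟙 (b k) ≤ ∑[ i < suc n ] 𝟙 (b i) →
                ∃[ i ] i ≢ k × b i ≡ true
∃-true-except {n} b k h = punchIn k i , punchInᵢ≢i k i , bi
  where
  rest≥1 : 1 ≤ ∑[ i < n ] 𝟙 (b (punchIn k i))
  rest≥1 = +-cancelˡ-≤ (𝟙 (b k)) 1 _ (subst₂ _≤_ (+-comm 1 (𝟙 (b k))) (sum-remove (𝟙 ∘ b)) h)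
  i = proj₁ (∃-true (b ∘ punchIn k) rest≥1)
  bi = proj₂ (∃-true (b ∘ punchIn k) rest≥1)

sum-map-tabulate : ∀ {A : Set} {n} (g : Fin n → A) (f : A → ℕ) →
                   List.sum (map f (tabulate g)) ≡ ∑[ i < n ] f (g i)
sum-map-tabulate {n = zero}  g f = refl
sum-map-tabulate {n = suc n} g f = cong (f (g zero) +_) (sum-map-tabulate (g ∘ suc) f)

sum-map-cartesianProduct : ∀ {A B : Set} (f : A × B → ℕ) xs ys →
  List.sum (map f (cartesianProduct xs ys)) ≡ List.sum (map (λ x → List.sum (map (λ y → f (x , y)) ys)) xs)
sum-map-cartesianProduct f []       ys = refl
sum-map-cartesianProduct f (x ∷ xs) ys = begin
  List.sum (map f (map (x ,_) ys ++ cartesianProduct xs ys))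
    ≡⟨ cong List.sum (map-++ f (map (x ,_) ys) (cartesianProduct xs ys)) ⟩
  List.sum (map f (map (x ,_) ys) ++ map f (cartesianProduct xs ys))
    ≡⟨ sum-++ (map f (map (x ,_) ys)) (map f (cartesianProduct xs ys)) ⟩
  List.sum (map f (map (x ,_) ys)) + List.sum (map f (cartesianProduct xs ys))
    ≡⟨ cong₂ _+_ (cong List.sum (sym (map-∘ ys))) (sum-map-cartesianProduct f xs ys) ⟩
  List.sum (map (λ y → f (x , y)) ys) + List.sum (map (λ x → List.sum (map (λ y → f (x , y)) ys)) xs)
    ∎
  where open ≡-Reasoning

sum-vertices : ∀ {n} (f : Vertex n → ℕ) → List.sum (map f (vertices n)) ≡ ∑[ p < n ] ∑[ q < n ] f (p , q)
sum-vertices {n} f = begin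
  List.sum (map f (vertices n))
    ≡⟨ sum-map-cartesianProduct f (allFin n) (allFin n) ⟩
  List.sum (map (λ p → List.sum (map (λ q → f (p , q)) (allFin n))) (allFin n))
    ≡⟨ sum-map-tabulate {n = n} id (λ p → List.sum (map (λ q → f (p , q)) (allFin n))) ⟩
  ∑[ p < n ] List.sum (map (λ q → f (p , q)) (allFin n))
    ≡⟨ sum-cong-≗ (λ p → sum-map-tabulate id (λ q → f (p , q))) ⟩
  ∑[ p < n ] ∑[ q < n ] f (p , q)
    ∎
  where open ≡-Reasoning

-- Distances in K_n × K_n

⌊≟⌋-refl : ∀ {n} (i : Fin n) → ⌊ i ≟ i ⌋ ≡ true
⌊≟⌋-refl i = trans (isYes≗does (i ≟ i)) (dec-true (i ≟ i) refl)

⌊≟⌋-≢ : ∀ {n} {i j : Fin n} → i ≢ j → ⌊ i ≟ j ⌋ ≡ false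
⌊≟⌋-≢ {i = i} {j} i≢j = trans (isYes≗does (i ≟ j)) (dec-false (i ≟ j) i≢j)

eqV-refl : ∀ {n} (x : Vertex n) → eqV x x ≡ true
eqV-refl (i , j) = cong₂ _∧_ (⌊≟⌋-refl i) (⌊≟⌋-refl j)

eqV⇒≡ : ∀ {n} {x z : Vertex n} → eqV x z ≡ true → x ≡ z
eqV⇒≡ {x = i , j} {p , q} eq with i ≟ p | j ≟ q
eqV⇒≡ {x = i , j} {p , q} eq  | yes refl | yes refl = refl
eqV⇒≡ {x = i , j} {p , q} () | yes _    | no _
eqV⇒≡ {x = i , j} {p , q} () | no _     | _

adj-≢ : ∀ {n} {i j p q : Fin n} → i ≢ p → j ≢ q → adj (i , j) (p , q) ≡ true
adj-≢ i≢p j≢q = cong₂ _∧_ (cong not (⌊≟⌋-≢ i≢p)) (cong not (⌊≟⌋-≢ j≢q))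

∈-vertices : ∀ {n} (x : Vertex n) → x ∈ vertices n
∈-vertices (i , j) = ∈-cartesianProduct⁺ (∈-allFin i) (∈-allFin j)

any-≡true : ∀ {A : Set} (f : A → Bool) {x xs} → x ∈ xs → f x ≡ true → any f xs ≡ true
any-≡true f x∈xs fx = Equivalence.to T-≡ (any⁺ f (lose x∈xs (Equivalence.from T-≡ fx)))

any-≡false : ∀ {A : Set} {f : A → Bool} xs → (∀ x → f x ≡ false) → any f xs ≡ false
any-≡false []       _ = refl
any-≡false (x ∷ xs) f≡false rewrite f≡false x = any-≡false xs f≡false

any-∧-eqV : ∀ {n} (f : Vertex n → Bool) z → any (λ w → f w ∧ eqV w z) (vertices n) ≡ f z
any-∧-eqV {n} f z with f z in fz
... | true  = any-≡true (λ w → f w ∧ eqV w z) (∈-vertices z) (trans (cong (_∧ eqV z z) fz) (eqV-refl z))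
... | false = any-≡false (vertices n) f∧eqV≡false
  where
  f∧eqV≡false : ∀ w → (f w ∧ eqV w z) ≡ false
  f∧eqV≡false w with eqV w z in wz
  ... | false = ∧-zeroʳ (f w)
  ... | true  = trans (∧-identityʳ (f w)) (subst (λ v → f v ≡ false) (sym (eqV⇒≡ wz)) fz)

∃-avoiding : ∀ {n} → 3 ≤ n → (a b : Fin n) → ∃[ c ] a ≢ c × c ≢ b
∃-avoiding (s≤s (s≤s (s≤s _))) a b with a ≟ 0F | b ≟ 0F
... | no a≢0 | no b≢0 = 0F , a≢0 , b≢0 ∘ sym
... | yes refl | _ with b ≟ 1F
...   | no b≢1   = 1F , (λ ()) , b≢1 ∘ sym
...   | yes refl = 2F , (λ ()) , (λ ())
∃-avoiding (s≤s (s≤s (s≤s _))) a b | no _ | yes refl with a ≟ 1F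
...   | no a≢1   = 1F , a≢1 , (λ ())
...   | yes refl = 2F , (λ ()) , (λ ())

d : ∀ {n} → Vertex n → Vertex n → ℕ
d x z = if eqV x z then 0 else if adj x z then 1 else 2

reach-1 : ∀ n (x z : Vertex n) → reach n 1 x z ≡ eqV x z ∨ adj x z
reach-1 n x z = cong (eqV x z ∨_) (any-∧-eqV (adj x) z)

reach-2 : ∀ {n} → 3 ≤ n → (x z : Vertex n) → reach n 2 x z ≡ true
reach-2 {n} 3≤n (i , j) (p , q) = trans (cong (reach n 1 (i , j) (p , q) ∨_) viaW) (∨-zeroʳ _)
  where
  c = ∃-avoiding 3≤n i p
  c′ = ∃-avoiding 3≤n j q
  w : Vertex n
  w = proj₁ c , proj₁ c′
  w~z : reach n 1 w (p , q) ≡ true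
  w~z = trans (reach-1 n w (p , q)) (trans (cong (eqV w (p , q) ∨_) (adj-≢ (proj₂ (proj₂ c)) (proj₂ (proj₂ c′)))) (∨-zeroʳ _))
  viaW : any (λ v → adj (i , j) v ∧ reach n 1 v (p , q)) (vertices n) ≡ true
  viaW = any-≡true _ (∈-vertices w) (cong₂ _∧_ (adj-≢ (proj₁ (proj₂ c)) (proj₁ (proj₂ c′))) w~z)

leastFrom-≤2 : ∀ fuel (p : ℕ → Bool) → p 2 ≡ true →
               leastFrom (3 + fuel) 0 p ≡ (if p 0 then 0 else if p 1 then 1 else 2)
leastFrom-≤2 fuel p p₂ with p 0 | p 1
... | true  | _     = refl
... | false | true  = refl
... | false | false rewrite p₂ = refl

dist≡d : ∀ {n} → 3 ≤ n → (x z : Vertex n) → dist n x z ≡ d x z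
dist≡d {n@(suc (suc (suc m)))} 3≤n@(s≤s (s≤s (s≤s _))) x z = begin
  dist n x z
    ≡⟨ leastFrom-≤2 (m + (2 + m) * n) (λ k → reach n k x z) (reach-2 3≤n x z) ⟩
  (if eqV x z then 0 else if reach n 1 x z then 1 else 2)
    ≡⟨ cong (λ b → if eqV x z then 0 else if b then 1 else 2) (reach-1 n x z) ⟩
  (if eqV x z then 0 else if eqV x z ∨ adj x z then 1 else 2)
    ≡⟨ drop-eqV (eqV x z) ⟩
  d x z
    ∎
  where
  open ≡-Reasoning
  drop-eqV : ∀ e → (if e then 0 else if e ∨ adj x z then 1 else 2) ≡ (if e then 0 else if adj x z then 1 else 2)
  drop-eqV true  = refl
  drop-eqV false = refl

-- Δ_S in terms of row and column counts

Δd : ∀ {n} → Vertex n → Vertex n → Fin n → Fin n → ℕ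
Δd x y p q = ∣ d x (p , q) - d y (p , q) ∣

Δd-sameRow : ∀ {n} {j j′ : Fin n} → j ≢ j′ → ∀ i p q →
             Δd (i , j) (i , j′) p q ≡ δ j q + δ j′ q + δ i p * δ j q + δ i p * δ j′ q
Δd-sameRow {j = j} {j′} j≢j′ i p q with i ≟ p | j ≟ q | j′ ≟ q
... | _     | yes refl | yes refl = ⊥-elim (j≢j′ refl)
... | yes _ | yes _    | no _     = refl
... | yes _ | no _     | yes _    = refl
... | yes _ | no _     | no _     = refl
... | no _  | yes _    | no _     = refl
... | no _  | no _     | yes _    = refl
... | no _  | no _     | no _     = refl

Δd-sameCol : ∀ {n} {i i′ : Fin n} → i ≢ i′ → ∀ j p q →
             Δd (i , j) (i′ , j) p q ≡ δ i p + δ i′ p + δ i p * δ j q + δ i′ p * δ j q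
Δd-sameCol {i = i} {i′} i≢i′ j p q with i ≟ p | i′ ≟ p | j ≟ q
... | yes refl | yes refl | _     = ⊥-elim (i≢i′ refl)
... | yes _    | no _     | yes _ = refl
... | yes _    | no _     | no _  = refl
... | no _     | yes _    | yes _ = refl
... | no _     | yes _    | no _  = refl
... | no _     | no _     | yes _ = refl
... | no _     | no _     | no _  = refl

-- The corner terms are moved to the left so that no truncated subtraction occurs.
Δd-generic : ∀ {n} {i i′ j j′ : Fin n} → i ≢ i′ → j ≢ j′ → ∀ p q →
             Δd (i , j) (i′ , j′) p q
               + (δ i p * δ j q + δ i′ p * δ j′ q + 2 * (δ i p * δ j′ q + δ i′ p * δ j q))
             ≡ δ i p + δ i′ p + δ j q + δ j′ q
Δd-generic {i = i} {i′} {j} {j′} i≢i′ j≢j′ p q with i ≟ p | i′ ≟ p | j ≟ q | j′ ≟ q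
... | yes refl | yes refl | _        | _        = ⊥-elim (i≢i′ refl)
... | _        | _        | yes refl | yes refl = ⊥-elim (j≢j′ refl)
... | yes _ | no _  | yes _ | no _  = refl
... | yes _ | no _  | no _  | yes _ = refl
... | yes _ | no _  | no _  | no _  = refl
... | no _  | yes _ | yes _ | no _  = refl
... | no _  | yes _ | no _  | yes _ = refl
... | no _  | yes _ | no _  | no _  = refl
... | no _  | no _  | yes _ | no _  = refl
... | no _  | no _  | no _  | yes _ = refl
... | no _  | no _  | no _  | no _  = refl

entry : ∀ {n} → VSet n → Fin n → Fin n → ℕ
entry S i j = 𝟙 (S (i , j))

rowCount colCount : ∀ {n} → VSet n → Fin n → ℕ
rowCount {n} S i = ∑[ j < n ] entry S i j
colCount {n} S j = ∑[ i < n ] entry S i j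

card≡∑rowCount : ∀ {n} (S : VSet n) → card S ≡ ∑[ i < n ] rowCount S i
card≡∑rowCount S = sum-vertices (λ z → if S z then 1 else 0)

card≡∑colCount : ∀ {n} (S : VSet n) → card S ≡ ∑[ j < n ] colCount S j
card≡∑colCount S = trans (card≡∑rowCount S) (∑-comm (entry S))

weigh : ∀ {n} → VSet n → (Fin n → Fin n → ℕ) → ℕ
weigh {n} S w = ∑[ p < n ] ∑[ q < n ] (w p q * entry S p q)

ΔS≡weigh : ∀ {n} → 3 ≤ n → (S : VSet n) (x y : Vertex n) → ΔS n S x y ≡ weigh S (Δd x y)
ΔS≡weigh {n} 3≤n S x y =
  trans (sum-vertices (λ z → if S z then Δ n z x y else 0)) (sum-cong-≗ {n} λ p → sum-cong-≗ {n} λ q →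
    trans (if-then-0≡*𝟙 (S (p , q)) _)
          (cong (_* entry S p q) (cong₂ ∣_-_∣ (dist≡d 3≤n x (p , q)) (dist≡d 3≤n y (p , q)))))

module _ {n} (S : VSet n) where

  weigh-cong : {w v : Fin n → Fin n → ℕ} → (∀ p q → w p q ≡ v p q) → weigh S w ≡ weigh S v
  weigh-cong w≡v = sum-cong-≗ {n} λ p → sum-cong-≗ {n} λ q → cong (_* entry S p q) (w≡v p q)

  weigh-+ : (w v : Fin n → Fin n → ℕ) → weigh S (λ p q → w p q + v p q) ≡ weigh S w + weigh S v
  weigh-+ w v = trans
    (sum-cong-≗ {n} λ p → trans (sum-cong-≗ {n} λ q → *-distribʳ-+ (entry S p q) (w p q) (v p q))
                                (∑-distrib-+ (λ q → w p q * entry S p q) (λ q → v p q * entry S p q)))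
    (∑-distrib-+ (λ p → ∑[ q < n ] (w p q * entry S p q)) (λ p → ∑[ q < n ] (v p q * entry S p q)))

  weigh-+₄ : (w₁ w₂ w₃ w₄ : Fin n → Fin n → ℕ) →
             weigh S (λ p q → w₁ p q + w₂ p q + w₃ p q + w₄ p q) ≡ weigh S w₁ + weigh S w₂ + weigh S w₃ + weigh S w₄
  weigh-+₄ w₁ w₂ w₃ w₄ = begin
    weigh S (λ p q → w₁ p q + w₂ p q + w₃ p q + w₄ p q)           ≡⟨ weigh-+ (λ p q → w₁ p q + w₂ p q + w₃ p q) w₄ ⟩
    weigh S (λ p q → w₁ p q + w₂ p q + w₃ p q) + weigh S w₄       ≡⟨ cong (_+ weigh S w₄) (weigh-+ (λ p q → w₁ p q + w₂ p q) w₃) ⟩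
    weigh S (λ p q → w₁ p q + w₂ p q) + weigh S w₃ + weigh S w₄   ≡⟨ cong (λ t → t + weigh S w₃ + weigh S w₄) (weigh-+ w₁ w₂) ⟩
    weigh S w₁ + weigh S w₂ + weigh S w₃ + weigh S w₄             ∎
    where open ≡-Reasoning

  weigh-* : ∀ k (w : Fin n → Fin n → ℕ) → weigh S (λ p q → k * w p q) ≡ k * weigh S w
  weigh-* k w = sym (trans (*-distribˡ-sum k (λ p → ∑[ q < n ] (w p q * entry S p q))) (sum-cong-≗ {n} λ p →
    trans (*-distribˡ-sum k (λ q → w p q * entry S p q)) (sum-cong-≗ {n} λ q → sym (*-assoc k (w p q) (entry S p q)))))

  weigh-row : ∀ i → weigh S (λ p q → δ i p) ≡ rowCount S i
  weigh-row i = trans (sum-cong-≗ {n} λ p → sym (*-distribˡ-sum (δ i p) (entry S p))) (∑-δ* i (rowCount S))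

  weigh-col : ∀ j → weigh S (λ p q → δ j q) ≡ colCount S j
  weigh-col j = sum-cong-≗ {n} λ p → ∑-δ* j (entry S p)

  weigh-point : ∀ i j → weigh S (λ p q → δ i p * δ j q) ≡ entry S i j
  weigh-point i j = trans
    (sum-cong-≗ {n} λ p → trans (sum-cong-≗ {n} λ q → *-assoc (δ i p) (δ j q) (entry S p q))
                                (trans (sym (*-distribˡ-sum (δ i p) (λ q → δ j q * entry S p q)))
                                       (cong (δ i p *_) (∑-δ* j (entry S p)))))
    (∑-δ* i (λ p → entry S p j))

module _ {n} (3≤n : 3 ≤ n) (S : VSet n) where

  ΔS-sameRow : ∀ {i j j′} → j ≢ j′ →
               ΔS n S (i , j) (i , j′) ≡ colCount S j + colCount S j′ + entry S i j + entry S i j′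
  ΔS-sameRow {i} {j} {j′} j≢j′ = begin
    ΔS n S (i , j) (i , j′)
      ≡⟨ ΔS≡weigh 3≤n S (i , j) (i , j′) ⟩
    weigh S (Δd (i , j) (i , j′))
      ≡⟨ weigh-cong S (Δd-sameRow j≢j′ i) ⟩
    weigh S (λ p q → δ j q + δ j′ q + δ i p * δ j q + δ i p * δ j′ q)
      ≡⟨ weigh-+₄ S (λ p q → δ j q) (λ p q → δ j′ q) (λ p q → δ i p * δ j q) (λ p q → δ i p * δ j′ q) ⟩
    _ ≡⟨ cong₂ _+_ (cong₂ _+_ (cong₂ _+_ (weigh-col S j) (weigh-col S j′)) (weigh-point S i j)) (weigh-point S i j′) ⟩
    colCount S j + colCount S j′ + entry S i j + entry S i j′
      ∎
    where open ≡-Reasoning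

  ΔS-sameCol : ∀ {i i′ j} → i ≢ i′ →
               ΔS n S (i , j) (i′ , j) ≡ rowCount S i + rowCount S i′ + entry S i j + entry S i′ j
  ΔS-sameCol {i} {i′} {j} i≢i′ = begin
    ΔS n S (i , j) (i′ , j)
      ≡⟨ ΔS≡weigh 3≤n S (i , j) (i′ , j) ⟩
    weigh S (Δd (i , j) (i′ , j))
      ≡⟨ weigh-cong S (Δd-sameCol i≢i′ j) ⟩
    weigh S (λ p q → δ i p + δ i′ p + δ i p * δ j q + δ i′ p * δ j q)
      ≡⟨ weigh-+₄ S (λ p q → δ i p) (λ p q → δ i′ p) (λ p q → δ i p * δ j q) (λ p q → δ i′ p * δ j q) ⟩
    _ ≡⟨ cong₂ _+_ (cong₂ _+_ (cong₂ _+_ (weigh-row S i) (weigh-row S i′)) (weigh-point S i j)) (weigh-point S i′ j) ⟩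
    rowCount S i + rowCount S i′ + entry S i j + entry S i′ j
      ∎
    where open ≡-Reasoning

  ΔS-generic : ∀ {i i′ j j′} → i ≢ i′ → j ≢ j′ →
               ΔS n S (i , j) (i′ , j′) + (entry S i j + entry S i′ j′ + 2 * (entry S i j′ + entry S i′ j))
               ≡ rowCount S i + rowCount S i′ + colCount S j + colCount S j′
  ΔS-generic {i} {i′} {j} {j′} i≢i′ j≢j′ = begin
    ΔS n S (i , j) (i′ , j′) + (entry S i j + entry S i′ j′ + 2 * (entry S i j′ + entry S i′ j))
      ≡⟨ cong₂ _+_ (ΔS≡weigh 3≤n S (i , j) (i′ , j′)) (sym weigh-corners) ⟩
    weigh S (Δd (i , j) (i′ , j′)) + weigh S corners
      ≡⟨ weigh-+ S (Δd (i , j) (i′ , j′)) corners ⟨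
    weigh S (λ p q → Δd (i , j) (i′ , j′) p q + corners p q)
      ≡⟨ weigh-cong S (Δd-generic i≢i′ j≢j′) ⟩
    weigh S (λ p q → δ i p + δ i′ p + δ j q + δ j′ q)
      ≡⟨ weigh-+₄ S (λ p q → δ i p) (λ p q → δ i′ p) (λ p q → δ j q) (λ p q → δ j′ q) ⟩
    _ ≡⟨ cong₂ _+_ (cong₂ _+_ (cong₂ _+_ (weigh-row S i) (weigh-row S i′)) (weigh-col S j)) (weigh-col S j′) ⟩
    rowCount S i + rowCount S i′ + colCount S j + colCount S j′
      ∎
    where
    open ≡-Reasoning
    corners : Fin n → Fin n → ℕ
    corners p q = δ i p * δ j q + δ i′ p * δ j′ q + 2 * (δ i p * δ j′ q + δ i′ p * δ j q)
    weigh-corners : weigh S corners ≡ entry S i j + entry S i′ j′ + 2 * (entry S i j′ + entry S i′ j)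
    weigh-corners = trans (weigh-+ S (λ p q → δ i p * δ j q + δ i′ p * δ j′ q) (λ p q → 2 * (δ i p * δ j′ q + δ i′ p * δ j q)))
      (cong₂ _+_ (trans (weigh-+ S (λ p q → δ i p * δ j q) (λ p q → δ i′ p * δ j′ q)) (cong₂ _+_ (weigh-point S i j) (weigh-point S i′ j′)))
                 (trans (weigh-* S 2 (λ p q → δ i p * δ j′ q + δ i′ p * δ j q))
                        (cong (2 *_) (trans (weigh-+ S (λ p q → δ i p * δ j′ q) (λ p q → δ i′ p * δ j q))
                                            (cong₂ _+_ (weigh-point S i j′) (weigh-point S i′ j))))))

-- The lower bound

∑+∑≥3 : ∀ {n} → 3 ≤ n → (a b : Fin n → ℕ) →
        (∀ i → 3 ≤ ∑[ k < n ] a k + ∑[ k < n ] b k + a i + b i) → 3 ≤ ∑[ k < n ] a k + ∑[ k < n ] b k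
∑+∑≥3 {n} 3≤n a b h with 3 ≤? ∑[ k < n ] a k + ∑[ k < n ] b k
... | yes 3≤A+B = 3≤A+B
... | no 3≰A+B  = ⊥-elim (<⇒≱ (≤-trans (s≤s A+B≤2) 3≤n) n≤A+B)
  where
  A+B≤2 : ∑[ k < n ] a k + ∑[ k < n ] b k ≤ 2
  A+B≤2 = ≤-pred (≰⇒> 3≰A+B)
  hit : ∀ i → 1 ≤ a i + b i
  hit i = s≤s⁻¹ (s≤s⁻¹ (≤-trans (subst (3 ≤_) (+-assoc _ (a i) (b i)) (h i)) (+-monoˡ-≤ (a i + b i) A+B≤2)))
  n≤A+B : n ≤ ∑[ k < n ] a k + ∑[ k < n ] b k
  n≤A+B = subst₂ _≤_ (*-identityʳ n) (∑-distrib-+ a b) (n*m≤∑ hit)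

Pairwise≥3 : ∀ {n} → (Fin n → ℕ) → Set
Pairwise≥3 c = ∀ {j j′} → j ≢ j′ → 3 ≤ c j + c j′

Deficient : ∀ {n} → (Fin n → ℕ) → Fin n → Set
Deficient c j₀ = c j₀ ≡ 1 × (∀ j → j ≢ j₀ → 2 ≤ c j)

pairwise≥3⇒large⊎deficient : ∀ {n} → 3 ≤ n → (c : Fin n → ℕ) → Pairwise≥3 c →
                             2 * n ≤ ∑[ j < n ] c j ⊎ ∃[ j₀ ] Deficient c j₀
pairwise≥3⇒large⊎deficient {n} 3≤n@(s≤s (s≤s (s≤s {n = k} _))) c pairs with any? (λ j → c j ≤? 1)
... | no ∄small = inj₁ (subst (_≤ ∑[ j < n ] c j) (*-comm n 2) (n*m≤∑ λ j → ≰⇒> (∄small ∘ (j ,_))))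
... | yes (j₀ , cj₀≤1) with c j₀ in cj₀≡ | cj₀≤1
...   | 0           | _      = inj₁ (begin
        2 * n                         ≡⟨ *-comm 2 n ⟩
        6 + k * 2                     ≤⟨ +-monoʳ-≤ 6 (*-monoʳ-≤ k (n≤1+n 2)) ⟩
        (2 + k) * 3                   ≡⟨ cong (_+ (2 + k) * 3) cj₀≡ ⟨
        c j₀ + (2 + k) * 3            ≤⟨ ∑-≥-except c j₀ (λ j j≢j₀ → subst (λ t → 3 ≤ t + c j) cj₀≡ (pairs (j≢j₀ ∘ sym))) ⟩
        ∑[ j < n ] c j                ∎)
  where open ≤-Reasoning
...   | 1           | _      = inj₂ (j₀ , cj₀≡ , λ j j≢j₀ → s≤s⁻¹ (subst (λ t → 3 ≤ t + c j) cj₀≡ (pairs (j≢j₀ ∘ sym))))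
...   | suc (suc _) | s≤s ()

deficient-bump : ∀ {n} (c : Fin (2 + n) → ℕ) {j₀ j} → Deficient c j₀ → j ≢ j₀ → 3 ≤ c j →
                 2 * (2 + n) ≤ ∑[ k < 2 + n ] c k
deficient-bump {n} c {j₀} {j} (cj₀≡1 , others≥2) j≢j₀ 3≤cj = begin
  2 * (2 + n)          ≡⟨ *-comm 2 (2 + n) ⟩
  1 + 3 + n * 2        ≤⟨ +-monoˡ-≤ (n * 2) (+-mono-≤ (≤-reflexive (sym cj₀≡1)) 3≤cj) ⟩
  c j₀ + c j + n * 2   ≤⟨ ∑-≥-except₂ c (j≢j₀ ∘ sym) (λ k k≢j₀ _ → others≥2 k k≢j₀) ⟩
  ∑[ k < 2 + n ] c k   ∎
  where open ≤-Reasoning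

5≤+⇒3≤⊎3≤ : ∀ {x y} → 5 ≤ x + y → 3 ≤ x ⊎ 3 ≤ y
5≤+⇒3≤⊎3≤ {x} {y} 5≤x+y with 3 ≤? x
... | yes 3≤x = inj₁ 3≤x
... | no 3≰x  = inj₂ (s≤s⁻¹ (s≤s⁻¹ (≤-trans 5≤x+y (+-monoˡ-≤ y (≤-pred (≰⇒> 3≰x))))))

Diagonal≥7 : ∀ {n} → VSet n → Set
Diagonal≥7 S = ∀ {i i′ j j′} → i ≢ i′ → j ≢ j′ → S (i , j′) ≡ true → S (i′ , j) ≡ true →
               7 ≤ rowCount S i + rowCount S i′ + colCount S j + colCount S j′

-- If (i₀ , j₀) ∈ S, pair it with a point of another column outside row i₀;
-- otherwise pair the single points of row i₀ and of column j₀.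
heavyLines : ∀ {n} (S : VSet (2 + n)) {i₀ j₀} → Deficient (rowCount S) i₀ → Deficient (colCount S) j₀ →
             Diagonal≥7 S → ∃[ i ] ∃[ j ] i ≢ i₀ × j ≢ j₀ × 5 ≤ rowCount S i + colCount S j
heavyLines S {i₀} {j₀} (ri₀≡1 , _) (cj₀≡1 , cols≥2) diagonal with S (i₀ , j₀) in Si₀j₀
... | true = i , j , i≢i₀ , j≢j₀ , s≤s⁻¹ (s≤s⁻¹ (subst (7 ≤_) lines≡ 7≤lines))
  where
  j = punchIn j₀ 0F
  j≢j₀ = punchInᵢ≢i j₀ 0F
  found = ∃-true-except (λ i → S (i , j)) i₀ (≤-trans (s≤s (𝟙≤1 (S (i₀ , j)))) (cols≥2 j j≢j₀))
  i = proj₁ found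
  i≢i₀ = proj₁ (proj₂ found)
  7≤lines = diagonal (i≢i₀ ∘ sym) j≢j₀ Si₀j₀ (proj₂ (proj₂ found))
  lines≡ : rowCount S i₀ + rowCount S i + colCount S j + colCount S j₀ ≡ 2 + (rowCount S i + colCount S j)
  lines≡ = trans (cong₂ (λ r c → r + rowCount S i + colCount S j + c) ri₀≡1 cj₀≡1)
                 (+-comm (1 + rowCount S i + colCount S j) 1)
... | false = a , b , a≢i₀ , b≢j₀ , s≤s⁻¹ (s≤s⁻¹ (subst (7 ≤_) lines≡ 7≤lines))
  where
  inCol = ∃-true-except (λ i → S (i , j₀)) i₀ (subst₂ (λ s c → 1 + 𝟙 s ≤ c) (sym Si₀j₀) (sym cj₀≡1) ≤-refl)
  inRow = ∃-true-except (λ j → S (i₀ , j)) j₀ (subst₂ (λ s r → 1 + 𝟙 s ≤ r) (sym Si₀j₀) (sym ri₀≡1) ≤-refl)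
  a = proj₁ inCol
  a≢i₀ = proj₁ (proj₂ inCol)
  b = proj₁ inRow
  b≢j₀ = proj₁ (proj₂ inRow)
  7≤lines = diagonal (a≢i₀ ∘ sym) (b≢j₀ ∘ sym) (proj₂ (proj₂ inRow)) (proj₂ (proj₂ inCol))
  lines≡ : rowCount S i₀ + rowCount S a + colCount S j₀ + colCount S b ≡ 2 + (rowCount S a + colCount S b)
  lines≡ = trans (cong₂ (λ r c → r + rowCount S a + c + colCount S b) ri₀≡1 cj₀≡1)
                 (cong suc (cong (_+ colCount S b) (+-comm (rowCount S a) 1)))

2n≤card : ∀ {n} → 3 ≤ n → (S : VSet n) → Pairwise≥3 (rowCount S) → Pairwise≥3 (colCount S) → Diagonal≥7 S →
          2 * n ≤ card S
2n≤card {n} 3≤n@(s≤s (s≤s (s≤s _))) S rows cols diagonal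
  with pairwise≥3⇒large⊎deficient 3≤n (rowCount S) rows | pairwise≥3⇒large⊎deficient 3≤n (colCount S) cols
... | inj₁ 2n≤∑r | _          = subst (2 * n ≤_) (sym (card≡∑rowCount S)) 2n≤∑r
... | inj₂ _     | inj₁ 2n≤∑c = subst (2 * n ≤_) (sym (card≡∑colCount S)) 2n≤∑c
... | inj₂ (i₀ , rdef) | inj₂ (j₀ , cdef) with heavyLines S rdef cdef diagonal
...   | i , j , i≢i₀ , j≢j₀ , 5≤ri+cj with 5≤+⇒3≤⊎3≤ 5≤ri+cj
...     | inj₁ 3≤ri = subst (2 * n ≤_) (sym (card≡∑rowCount S)) (deficient-bump (rowCount S) rdef i≢i₀ 3≤ri)
...     | inj₂ 3≤cj = subst (2 * n ≤_) (sym (card≡∑colCount S)) (deficient-bump (colCount S) cdef j≢j₀ 3≤cj)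

module _ {n} (3≤n : 3 ≤ n) (S : VSet n) (resolving : WeakResolving n 3 S) where

  resolving⇒rows : Pairwise≥3 (rowCount S)
  resolving⇒rows {i} {i′} i≢i′ = ∑+∑≥3 3≤n (entry S i) (entry S i′) λ j →
    subst (3 ≤_) (ΔS-sameCol 3≤n S {j = j} i≢i′) (resolving (i , j) (i′ , j) (i≢i′ ∘ cong proj₁))

  resolving⇒cols : Pairwise≥3 (colCount S)
  resolving⇒cols {j} {j′} j≢j′ = ∑+∑≥3 3≤n (λ i → entry S i j) (λ i → entry S i j′) λ i →
    subst (3 ≤_) (ΔS-sameRow 3≤n S {i} j≢j′) (resolving (i , j) (i , j′) (j≢j′ ∘ cong proj₂))

  resolving⇒diagonal : Diagonal≥7 S
  resolving⇒diagonal {i} {i′} {j} {j′} i≢i′ j≢j′ Sij′ Si′j = begin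
    3 + 2 * (1 + 1)
      ≤⟨ +-mono-≤ (resolving (i , j) (i′ , j′) (i≢i′ ∘ cong proj₁)) (m≤n+m _ (entry S i j + entry S i′ j′)) ⟩
    ΔS n S (i , j) (i′ , j′) + (entry S i j + entry S i′ j′ + 2 * (1 + 1))
      ≡⟨ cong₂ (λ s t → ΔS n S (i , j) (i′ , j′) + (entry S i j + entry S i′ j′ + 2 * (𝟙 s + 𝟙 t))) Sij′ Si′j ⟨
    ΔS n S (i , j) (i′ , j′) + (entry S i j + entry S i′ j′ + 2 * (entry S i j′ + entry S i′ j))
      ≡⟨ ΔS-generic 3≤n S i≢i′ j≢j′ ⟩
    rowCount S i + rowCount S i′ + colCount S j + colCount S j′
      ∎
    where open ≤-Reasoning

-- The upper bound

RectangleFree : ∀ {n} → VSet n → Set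
RectangleFree S = ∀ {i i′ j j′} → i ≢ i′ → j ≢ j′ →
                  S (i , j) ≡ true → S (i , j′) ≡ true → S (i′ , j) ≡ true → S (i′ , j′) ≡ true → ⊥

corners≤5 : ∀ a b c e → (a ≡ true → b ≡ true → c ≡ true → e ≡ true → ⊥) → 𝟙 a + 𝟙 e + 2 * (𝟙 b + 𝟙 c) ≤ 5
corners≤5 true  true  true  true  notAll = ⊥-elim (notAll refl refl refl refl)
corners≤5 true  true  true  false _ = ≤ᵇ⇒≤ _ 5 _
corners≤5 true  true  false true  _ = ≤ᵇ⇒≤ _ 5 _
corners≤5 true  true  false false _ = ≤ᵇ⇒≤ _ 5 _
corners≤5 true  false true  true  _ = ≤ᵇ⇒≤ _ 5 _
corners≤5 true  false true  false _ = ≤ᵇ⇒≤ _ 5 _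
corners≤5 true  false false true  _ = ≤ᵇ⇒≤ _ 5 _
corners≤5 true  false false false _ = ≤ᵇ⇒≤ _ 5 _
corners≤5 false true  true  true  _ = ≤ᵇ⇒≤ _ 5 _
corners≤5 false true  true  false _ = ≤ᵇ⇒≤ _ 5 _
corners≤5 false true  false true  _ = ≤ᵇ⇒≤ _ 5 _
corners≤5 false true  false false _ = ≤ᵇ⇒≤ _ 5 _
corners≤5 false false true  true  _ = ≤ᵇ⇒≤ _ 5 _
corners≤5 false false true  false _ = ≤ᵇ⇒≤ _ 5 _
corners≤5 false false false true  _ = ≤ᵇ⇒≤ _ 5 _
corners≤5 false false false false _ = ≤ᵇ⇒≤ _ 5 _

3≤a+b+x+y : ∀ {a b x y} → 2 ≤ a → 2 ≤ b → 3 ≤ a + b + x + y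
3≤a+b+x+y {a} {b} {x} {y} 2≤a 2≤b =
  ≤-trans (n≤1+n 3) (≤-trans (+-mono-≤ 2≤a 2≤b) (≤-trans (m≤m+n (a + b) x) (m≤m+n (a + b + x) y)))

rectangleFree⇒resolving : ∀ {n} → 3 ≤ n → (S : VSet n) → (∀ i → 2 ≤ rowCount S i) → (∀ j → 2 ≤ colCount S j) →
                          RectangleFree S → WeakResolving n 3 S
rectangleFree⇒resolving {n} 3≤n S rows≥2 cols≥2 rectangleFree (i , j) (i′ , j′) x≢y with i ≟ i′ | j ≟ j′
... | yes refl | yes refl = ⊥-elim (x≢y refl)
... | yes refl | no j≢j′  = subst (3 ≤_) (sym (ΔS-sameRow 3≤n S j≢j′)) (3≤a+b+x+y (cols≥2 j) (cols≥2 j′))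
... | no i≢i′  | yes refl = subst (3 ≤_) (sym (ΔS-sameCol 3≤n S i≢i′)) (3≤a+b+x+y (rows≥2 i) (rows≥2 i′))
... | no i≢i′  | no j≢j′  = +-cancelʳ-≤ 5 3 _ (begin
  8
    ≤⟨ +-mono-≤ (+-mono-≤ (+-mono-≤ (rows≥2 i) (rows≥2 i′)) (cols≥2 j)) (cols≥2 j′) ⟩
  rowCount S i + rowCount S i′ + colCount S j + colCount S j′
    ≡⟨ ΔS-generic 3≤n S i≢i′ j≢j′ ⟨
  ΔS n S (i , j) (i′ , j′) + (entry S i j + entry S i′ j′ + 2 * (entry S i j′ + entry S i′ j))
    ≤⟨ +-monoʳ-≤ (ΔS n S (i , j) (i′ , j′))
                 (corners≤5 (S (i , j)) (S (i , j′)) (S (i′ , j)) (S (i′ , j′)) (rectangleFree i≢i′ j≢j′)) ⟩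
  ΔS n S (i , j) (i′ , j′) + 5
    ∎)
  where open ≤-Reasoning

σ : ∀ {n} → Fin (suc n) → Fin (suc n)
σ zero    = fromℕ _
σ (suc i) = inject₁ i

σ-surjective : ∀ {n} (q : Fin (suc n)) → ∃[ p ] σ p ≡ q
σ-surjective {n} q with n ℕ.≟ toℕ q
... | yes n≡q = zero , toℕ-injective (trans (toℕ-fromℕ n) n≡q)
... | no n≢q  = suc (lower₁ q n≢q) , inject₁-lower₁ q n≢q

σ-fixedPointFree : ∀ {n} (p : Fin (2 + n)) → σ p ≢ p
σ-fixedPointFree zero    ()
σ-fixedPointFree (suc i) σi≡1+i = 1+n≢n (sym (trans (sym (toℕ-inject₁ i)) (cong toℕ σi≡1+i)))

σ²-fixedPointFree : ∀ {n} (p : Fin (3 + n)) → σ (σ p) ≢ p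
σ²-fixedPointFree zero          ()
σ²-fixedPointFree (suc zero)    ()
σ²-fixedPointFree (suc (suc i)) σ²p≡p =
  m≢1+n+m (toℕ i) (trans (sym (trans (toℕ-inject₁ (inject₁ i)) (toℕ-inject₁ i))) (cong toℕ σ²p≡p))

S₀ : ∀ {n} → VSet (suc n)
S₀ (p , q) = ⌊ p ≟ q ⌋ ∨ ⌊ σ p ≟ q ⌋

S₀-true : ∀ {n} {p q : Fin (suc n)} → S₀ (p , q) ≡ true → p ≡ q ⊎ σ p ≡ q
S₀-true {p = p} {q} S₀pq with p ≟ q | σ p ≟ q | S₀pq
... | yes p≡q | _        | _ = inj₁ p≡q
... | no _    | yes σp≡q | _ = inj₂ σp≡q
... | no _    | no _     | ()

S₀-diagonal : ∀ {n} (p : Fin (suc n)) → S₀ (p , p) ≡ true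
S₀-diagonal p = cong (_∨ ⌊ σ p ≟ p ⌋) (⌊≟⌋-refl p)

S₀-σ : ∀ {n} (p : Fin (suc n)) → S₀ (p , σ p) ≡ true
S₀-σ p = trans (cong (⌊ p ≟ σ p ⌋ ∨_) (⌊≟⌋-refl (σ p))) (∨-zeroʳ _)

S₀-row : ∀ {n} {i j j′ : Fin (suc n)} → j ≢ j′ → S₀ (i , j) ≡ true → S₀ (i , j′) ≡ true →
         (i ≡ j × σ i ≡ j′) ⊎ (σ i ≡ j × i ≡ j′)
S₀-row j≢j′ S₀ij S₀ij′ with S₀-true S₀ij | S₀-true S₀ij′
... | inj₁ i≡j  | inj₁ i≡j′  = ⊥-elim (j≢j′ (trans (sym i≡j) i≡j′))
... | inj₁ i≡j  | inj₂ σi≡j′ = inj₁ (i≡j , σi≡j′)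
... | inj₂ σi≡j | inj₁ i≡j′  = inj₂ (σi≡j , i≡j′)
... | inj₂ σi≡j | inj₂ σi≡j′ = ⊥-elim (j≢j′ (trans (sym σi≡j) σi≡j′))

S₀-rectangleFree : ∀ {n} → RectangleFree (S₀ {2 + n})
S₀-rectangleFree {i = i} {i′} i≢i′ j≢j′ S₀ij S₀ij′ S₀i′j S₀i′j′ with S₀-row j≢j′ S₀ij S₀ij′ | S₀-row j≢j′ S₀i′j S₀i′j′
... | inj₁ (i≡j , _)      | inj₁ (i′≡j , _)       = i≢i′ (trans i≡j (sym i′≡j))
... | inj₂ (_ , i≡j′)     | inj₂ (_ , i′≡j′)      = i≢i′ (trans i≡j′ (sym i′≡j′))
... | inj₁ (i≡j , σi≡j′)  | inj₂ (σi′≡j , i′≡j′)  =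
  σ²-fixedPointFree i (trans (cong σ (trans σi≡j′ (sym i′≡j′))) (trans σi′≡j (sym i≡j)))
... | inj₂ (σi≡j , i≡j′)  | inj₁ (i′≡j , σi′≡j′)  =
  σ²-fixedPointFree i (trans (cong σ (trans σi≡j (sym i′≡j))) (trans σi′≡j′ (sym i≡j′)))

entry-S₀ : ∀ {n} (p q : Fin (2 + n)) → entry S₀ p q ≡ δ p q + δ (σ p) q
entry-S₀ p q with p ≟ q | σ p ≟ q
... | yes refl | yes σp≡p = ⊥-elim (σ-fixedPointFree p σp≡p)
... | yes _    | no _     = refl
... | no _     | yes _    = refl
... | no _     | no _     = refl

rowCount-S₀ : ∀ {n} (p : Fin (2 + n)) → rowCount S₀ p ≡ 2
rowCount-S₀ {n} p = trans (sum-cong-≗ {2 + n} (entry-S₀ p))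
                          (trans (∑-distrib-+ (δ p) (δ (σ p))) (cong₂ _+_ (∑-δ p) (∑-δ (σ p))))

colCount-S₀ : ∀ {n} (q : Fin (2 + n)) → 2 ≤ colCount S₀ q
colCount-S₀ {n} q with σ-surjective q
... | p , refl = ≤-trans (≤-reflexive (sym two≡)) (∑-≥-except₂ (λ i → entry S₀ i (σ p)) p≢σp (λ _ _ _ → z≤n))
  where
  p≢σp : p ≢ σ p
  p≢σp = σ-fixedPointFree p ∘ sym
  two≡ : entry S₀ p (σ p) + entry S₀ (σ p) (σ p) + n * 0 ≡ 2
  two≡ = cong₂ _+_ (cong₂ (λ s t → 𝟙 s + 𝟙 t) (S₀-σ p) (S₀-diagonal (σ p))) (*-zeroʳ n)

card-S₀ : ∀ {n} → card (S₀ {suc n}) ≡ 2 * (2 + n)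
card-S₀ {n} = begin
  card (S₀ {suc n})                      ≡⟨ card≡∑rowCount (S₀ {suc n}) ⟩
  ∑[ p < 2 + n ] rowCount (S₀ {suc n}) p ≡⟨ sum-cong-≗ {2 + n} (rowCount-S₀ {n}) ⟩
  ∑[ p < 2 + n ] 2                       ≡⟨ ∑-const (2 + n) 2 ⟩
  (2 + n) * 2                            ≡⟨ *-comm (2 + n) 2 ⟩
  2 * (2 + n)                            ∎
  where open ≡-Reasoning

wdim₃≡2n : ∀ n → 3 ≤ n → WdimEq n 3 (2 * n)
wdim₃≡2n (suc (suc (suc m))) 3≤n@(s≤s (s≤s (s≤s _))) =
    ( S₀
    , rectangleFree⇒resolving 3≤n S₀ (≤-reflexive ∘ sym ∘ rowCount-S₀) colCount-S₀ S₀-rectangleFree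
    , card-S₀ {suc m} )
  , λ S resolving → 2n≤card 3≤n S (resolving⇒rows 3≤n S resolving) (resolving⇒cols 3≤n S resolving)
                              (resolving⇒diagonal 3≤n S resolving)

mainTheorem4 : (n : ℕ) → 4 ≤ n → WdimEq n 3 (2 * n)
mainTheorem4 n 4≤n = wdim₃≡2n n (≤-trans (n≤1+n 3) 4≤n)
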